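{- If $G$ is a minimally dependent oriented hypergraph, then any balanced subdivision of $G$ is minimally dependent.
   Context: An oriented hypergraph has disjoint finite sets of vertices and edges, incidences $(v,e,k)$ with $1\le k\le\iota(v,e)$, and an orientation $\sigma$ assigning $\pm1$ to each incidence. A circle is a cyclic sequence alternating distinct vertices and distinct edges joined by distinct incidences (with $k$ vertices, $k$ edges, $2k$ incidences). The incidence matrix has rows indexed by vertices, columns by edges, entries $\sum_k\sigma(v,e,k)$; minimally dependent means its columns are linearly dependent while every proper subfamily of columns is independent. An edge-subdivision of an edge $e$ partitions the incidences containing $e$ into two parts, replaces $e$ by new edges $e_1,e_2$ (incidences in the first part now contain $e_1$, those in the second contain $e_2$, orientations kept), and adds a new vertex $u$ with one incidence in $e_1$ and one in $e_2$. It is compatible if $\sigma(u,e_1)\sigma(u,e_2)=-1$, incompatible otherwise. A balanced subdivision of $G$ is an edge-subdivision of an edge of $G$, producing $H$, that is compatible, or incompatible with $u$ lying on no circle of $H$. -}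

module Defs where

open import Data.Nat as ℕ using (ℕ; zero; suc)
open import Data.Nat.DivMod using (_mod_)
open import Data.Fin as Fin using (Fin; zero; suc; toℕ; inject₁; fromℕ)
open import Data.Fin.Subset using (Subset; _∈_; _∉_; ⊤)
open import Data.Bool using (Bool; true; false; if_then_else_)
open import Data.Sign as Sign using (Sign)
open import Data.Rational as ℚ using (ℚ; 0ℚ; 1ℚ; _+_; _*_; -_)
open import Data.Product using (Σ; ∃; _×_; _,_)
open import Data.Sum using (_⊎_)
open import Relation.Nullary using (¬_; does)
open import Relation.Binary.PropositionalEquality using (_≡_; _≢_)
open import Function.Definitions using (Injective)

-- The incidences (v,e,k), 1 ≤ k ≤ ι(v,e), correspond to the i with
-- vert i ≡ v and edge i ≡ e (so ι(v,e) = number of such i).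

record OHG (n m : ℕ) : Set where
  field
    L    : ℕ
    vert : Fin L → Fin n
    edge : Fin L → Fin m
    sgn  : Fin L → Sign

open OHG public

Σℚ : (k : ℕ) → (Fin k → ℚ) → ℚ
Σℚ zero    f = 0ℚ
Σℚ (suc k) f = f zero + Σℚ k (λ i → f (suc i))

signℚ : Sign → ℚ
signℚ Sign.+ = 1ℚ
signℚ Sign.- = - 1ℚ

incMat : ∀ {n m} → OHG n m → Fin n → Fin m → ℚ
incMat G v e =
  Σℚ (L G) (λ i → if does (vert G i Fin.≟ v) then
                    (if does (edge G i Fin.≟ e) then signℚ (sgn G i) else 0ℚ)
                  else 0ℚ)

ColumnsDependent : ∀ {n m} → OHG n m → Subset m → Set
ColumnsDependent {n} {m} G S =
  Σ (Fin m → ℚ) λ c →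
      (∀ e → e ∉ S → c e ≡ 0ℚ)
    × (∃ λ e → c e ≢ 0ℚ)
    × (∀ v → Σℚ m (λ e → c e * incMat G v e) ≡ 0ℚ)

MinimallyDependent : ∀ {n m} → OHG n m → Set
MinimallyDependent {n} {m} G =
    ColumnsDependent G ⊤
  × (∀ (S : Subset m) → (∃ λ e → e ∉ S) → ¬ ColumnsDependent G S)

next : ∀ {k} → Fin (suc k) → Fin (suc k)
next {k} i = suc (toℕ i) mod (suc k)

record Circle {n m} (G : OHG n m) : Set where
  field
    k    : ℕ
    vs   : Fin (suc k) → Fin n
    es   : Fin (suc k) → Fin m
    a b  : Fin (suc k) → Fin (L G)
    vs-inj : Injective _≡_ _≡_ vs
    es-inj : Injective _≡_ _≡_ es
    a-inj  : Injective _≡_ _≡_ a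
    b-inj  : Injective _≡_ _≡_ b
    ab-dis : ∀ i j → a i ≢ b j
    a-vert : ∀ i → vert G (a i) ≡ vs i
    a-edge : ∀ i → edge G (a i) ≡ es i
    b-vert : ∀ i → vert G (b i) ≡ vs (next i)
    b-edge : ∀ i → edge G (b i) ≡ es i

OnCircle : ∀ {n m} → OHG n m → Fin n → Set
OnCircle G u = Σ (Circle G) λ C → ∃ λ i → Circle.vs C i ≡ u

-- Edge-subdivision of edge e of G.
-- part : which block each incidence containing e goes to (true ↦ e₁,
-- false ↦ e₂; its value on incidences not containing e is irrelevant).
-- s₁ s₂ : orientations σ(u,e₁), σ(u,e₂) of the new vertex's incidences.
-- In the result: new vertex u = fromℕ n, old vertex v ↦ inject₁ v;
-- e₁ = inject₁ e, e₂ = fromℕ m, other old edges f ↦ inject₁ f.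

newVertex : ∀ n → Fin (suc n)
newVertex n = fromℕ n

subdivide : ∀ {n m} (G : OHG n m) → Fin m → (Fin (L G) → Bool) → Sign → Sign
          → OHG (suc n) (suc m)
subdivide {n} {m} G e part s₁ s₂ = record
  { L    = suc (suc (L G))
  ; vert = vt
  ; edge = ed
  ; sgn  = sg
  }
  where
  vt : Fin (suc (suc (L G))) → Fin (suc n)
  vt zero          = fromℕ n
  vt (suc zero)    = fromℕ n
  vt (suc (suc i)) = inject₁ (vert G i)
  ed : Fin (suc (suc (L G))) → Fin (suc m)
  ed zero          = inject₁ e
  ed (suc zero)    = fromℕ m
  ed (suc (suc i)) =
    if does (edge G i Fin.≟ e)
      then (if part i then inject₁ e else fromℕ m)
      else inject₁ (edge G i)
  sg : Fin (suc (suc (L G))) → Sign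
  sg zero          = s₁
  sg (suc zero)    = s₂
  sg (suc (suc i)) = sgn G i

Compatible : Sign → Sign → Set
Compatible s₁ s₂ = s₁ Sign.* s₂ ≡ Sign.-

BalancedSubdivision : ∀ {n m} (G : OHG n m) → Fin m → (Fin (L G) → Bool)
                    → Sign → Sign → Set
BalancedSubdivision {n} G e part s₁ s₂ =
    Compatible s₁ s₂
  ⊎ (¬ Compatible s₁ s₂ × ¬ OnCircle (subdivide G e part s₁ s₂) (newVertex n))

-- Reversing the orientation of every incidence at a chosen set of vertices and edges multiplies
-- rows and columns of the incidence matrix by ±1, so it does not change which families of columns
-- are dependent. A compatible subdivision H of G has the same dependencies as G: a dependency of G
-- is copied onto e₁ and e₂, and the row of the new vertex u forces every dependency of H to agree
-- on e₁ and e₂, so it comes from one of G. If the subdivision is incompatible and u lies on no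
-- circle, then e₂ cannot be reached from e₁ in H − u, since a shortest path between them would
-- close up through u to a circle. Reversing all incidences at the vertices and edges of H − u not
-- reachable from e₁ therefore changes the orientation at u in e₂ only, which makes the subdivision
-- compatible.

module Submission where

open import Defs
open import Algebra.Bundles using (CommutativeRing)
open import Data.Bool using (Bool; true; false; if_then_else_; T; _∨_)
open import Data.Bool.Properties using (T-∨; T-≡; ⇔→≡; ¬-not)
open import Data.Empty using (⊥-elim)
open import Data.Fin using (Fin; zero; suc; toℕ; inject₁; fromℕ)
open import Data.Fin.Properties
  using (_≟_; any?; fromℕ≢inject₁; inject₁-injective; toℕ-injective; toℕ<n; toℕ≤pred[n];
         toℕ-inject₁; toℕ-fromℕ; toℕ-fromℕ<; suc-injective; injective⇒≤)
open import Data.Fin.Relation.Unary.Top using (view; ‵fromℕ; ‵inj₁; view-fromℕ; view-inject₁)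
open import Data.Fin.Subset using (_∉_; ⊤; ∁; ⁅_⁆)
open import Data.Fin.Subset.Properties using (∈⊤; x∈⁅x⁆; x∈⁅y⁆⇒x≡y; x∉∁p⇒x∈p; x∈p⇒x∉∁p)
open import Data.Nat as ℕ using (ℕ; zero; suc; _∸_; _<_; _≤_; z≤n; s≤s)
open import Data.Nat.DivMod using (m<n⇒m%n≡m; n%n≡0)
open import Data.Nat.Properties
  using (<-cmp; n<1+n; m<1+n⇒m<n∨m≡n; <⇒≤; ∸-cancelˡ-≡; n∸n≡0; 1+n≢n)
open import Data.Product using (∃; _×_; _,_; proj₁)
open import Data.Rational using (ℚ; 0ℚ; 1ℚ; _+_; _*_; -_; _-_)
open import Data.Rational.Properties
  using (+-*-commutativeRing; +-0-group; *-identityˡ; *-zeroʳ; *-comm; *-assoc;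
         +-identityˡ; +-identityʳ; +-inverseʳ)
open import Data.Rational.Solver using (module +-*-Solver)
open import Data.Sign as Sign using (Sign)
open import Data.Sum using (_⊎_; inj₁; inj₂; [_,_]; map₂)
open import Data.Vec.Functional using (_∷_)
open import Function using (_∘_; id; Equivalence; mk⇔)
open import Function.Definitions using (Injective)
open import Relation.Binary using (tri<; tri≈; tri>)
open import Relation.Nullary using (¬_; Dec; yes; no; does)
open import Relation.Nullary.Decidable using (isYes; T?; _×-dec_; toWitness; fromWitness; dec-true; dec-false)
open import Relation.Binary.PropositionalEquality
  using (_≡_; _≢_; refl; sym; trans; cong; cong₂; subst; subst₂; module ≡-Reasoning)
open import Algebra.Properties.Semiring.Sum (CommutativeRing.semiring +-*-commutativeRing)
  using (sum-syntax; ∑-comm; *-distribˡ-sum; sum-cong-≗; sum-replicate-zero)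
open import Algebra.Properties.Group +-0-group using (x∙y⁻¹≈ε⇒x≈y)
open import Algebra.Properties.CommutativeSemigroup
  (CommutativeRing.*-commutativeSemigroup +-*-commutativeRing) using (x∙yz≈y∙xz)

open ≡-Reasoning

signℚ-* : ∀ s t → signℚ (s Sign.* t) ≡ signℚ s * signℚ t
signℚ-* Sign.+ Sign.+ = refl
signℚ-* Sign.+ Sign.- = refl
signℚ-* Sign.- Sign.+ = refl
signℚ-* Sign.- Sign.- = refl

signℚ-involutive : ∀ s x → signℚ s * (signℚ s * x) ≡ x
signℚ-involutive Sign.+ x = trans (*-identityˡ _) (*-identityˡ x)
signℚ-involutive Sign.- x = trans (sym (*-assoc (- 1ℚ) (- 1ℚ) x)) (*-identityˡ x)

signℚ-*-assoc : ∀ s t x → signℚ s * (signℚ t * x) ≡ signℚ (s Sign.* t) * x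
signℚ-*-assoc s t x = trans (sym (*-assoc (signℚ s) (signℚ t) x)) (cong (_* x) (sym (signℚ-* s t)))

signℚ-cancel : ∀ s {x} → signℚ s * x ≡ 0ℚ → x ≡ 0ℚ
signℚ-cancel s {x} h = begin
  x                         ≡⟨ sym (signℚ-involutive s x) ⟩
  signℚ s * (signℚ s * x)   ≡⟨ cong (signℚ s *_) h ⟩
  signℚ s * 0ℚ              ≡⟨ *-zeroʳ (signℚ s) ⟩
  0ℚ                        ∎

*-distribˡ-difference : ∀ a x y → a * x + (- a) * y ≡ a * (x - y)
*-distribˡ-difference = solve 3 (λ a x y → a :* x :+ (:- a) :* y := a :* (x :- y)) refl
  where open +-*-Solver

compatible-factor : ∀ s t → Compatible s t → ∀ x y → signℚ s * x + signℚ t * y ≡ signℚ s * (x - y)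
compatible-factor Sign.+ Sign.- _ = *-distribˡ-difference 1ℚ
compatible-factor Sign.- Sign.+ _ = *-distribˡ-difference (- 1ℚ)

compatible-cancels : ∀ s t → Compatible s t → ∀ x → signℚ s * x + signℚ t * x ≡ 0ℚ
compatible-cancels s t c x =
  trans (compatible-factor s t c x x) (trans (cong (signℚ s *_) (+-inverseʳ x)) (*-zeroʳ (signℚ s)))

compatible-balanced : ∀ s t → Compatible s t → ∀ {x y} → signℚ s * x + signℚ t * y ≡ 0ℚ → x ≡ y
compatible-balanced s t c {x} {y} h =
  x∙y⁻¹≈ε⇒x≈y x y (signℚ-cancel s (trans (sym (compatible-factor s t c x y)) h))

¬Compatible⇒Compatible-switched : ∀ s t → ¬ Compatible s t → Compatible (s Sign.* Sign.+) (t Sign.* Sign.-)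
¬Compatible⇒Compatible-switched Sign.+ Sign.+ _ = refl
¬Compatible⇒Compatible-switched Sign.- Sign.- _ = refl
¬Compatible⇒Compatible-switched Sign.+ Sign.- c = ⊥-elim (c refl)
¬Compatible⇒Compatible-switched Sign.- Sign.+ c = ⊥-elim (c refl)

Σℚ≡sum : ∀ k (f : Fin k → ℚ) → Σℚ k f ≡ ∑[ i < k ] f i
Σℚ≡sum zero    f = refl
Σℚ≡sum (suc k) f = cong (f zero +_) (Σℚ≡sum k (f ∘ suc))

∑-indicator : ∀ {k} (x : Fin k) (h : Fin k → ℚ) → ∑[ f < k ] (if does (x ≟ f) then h f else 0ℚ) ≡ h x
∑-indicator {suc k} zero    h = trans (cong (h zero +_) (sum-replicate-zero k)) (+-identityʳ (h zero))
∑-indicator {suc k} (suc x) h = trans (+-identityˡ _) (∑-indicator x (h ∘ suc))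

does-inject₁-≟ : ∀ {k} (a b : Fin k) → does (inject₁ a ≟ inject₁ b) ≡ does (a ≟ b)
does-inject₁-≟ a b with a ≟ b
... | yes refl = dec-true (inject₁ a ≟ inject₁ a) refl
... | no a≢b   = dec-false (inject₁ a ≟ inject₁ b) (a≢b ∘ inject₁-injective)

next-inject₁ : ∀ {k} (i : Fin k) → next (inject₁ i) ≡ suc i
next-inject₁ {k} i = toℕ-injective (begin
  toℕ (next (inject₁ i))     ≡⟨ toℕ-fromℕ< _ ⟩
  suc (toℕ (inject₁ i)) ℕ.% suc k ≡⟨ m<n⇒m%n≡m (s≤s (subst (_< k) (sym (toℕ-inject₁ i)) (toℕ<n i))) ⟩
  suc (toℕ (inject₁ i))      ≡⟨ cong suc (toℕ-inject₁ i) ⟩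
  suc (toℕ i)                ∎)

next-fromℕ : ∀ k → next (fromℕ k) ≡ zero
next-fromℕ k = toℕ-injective (trans (toℕ-fromℕ< _)
  (trans (cong (λ j → suc j ℕ.% suc k) (toℕ-fromℕ k)) (n%n≡0 (suc k))))

module _ {n m} (G : OHG n m) where

  incidenceSum : (Fin (L G) → ℚ) → Fin n → ℚ
  incidenceSum x v = ∑[ i < L G ] (if does (vert G i ≟ v) then signℚ (sgn G i) * x i else 0ℚ)

  combination≡incidenceSum : ∀ (c : Fin m → ℚ) v →
    Σℚ m (λ f → c f * incMat G v f) ≡ incidenceSum (c ∘ edge G) v
  combination≡incidenceSum c v = begin
    Σℚ m (λ f → c f * incMat G v f)
      ≡⟨ Σℚ≡sum m _ ⟩
    ∑[ f < m ] (c f * incMat G v f)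
      ≡⟨ sum-cong-≗ (λ f → trans (cong (c f *_) (Σℚ≡sum (L G) (λ i → entry i f)))
                                   (*-distribˡ-sum (c f) (λ i → entry i f))) ⟩
    ∑[ f < m ] ∑[ i < L G ] (c f * entry i f)
      ≡⟨ ∑-comm (λ f i → c f * entry i f) ⟩
    ∑[ i < L G ] ∑[ f < m ] (c f * entry i f)
      ≡⟨ sum-cong-≗ column ⟩
    incidenceSum (c ∘ edge G) v ∎
    where
    entry : Fin (L G) → Fin m → ℚ
    entry i f = if does (vert G i ≟ v) then (if does (edge G i ≟ f) then signℚ (sgn G i) else 0ℚ) else 0ℚ

    weighted : ∀ i f → c f * (if does (edge G i ≟ f) then signℚ (sgn G i) else 0ℚ)
                     ≡ (if does (edge G i ≟ f) then signℚ (sgn G i) * c f else 0ℚ)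
    weighted i f with does (edge G i ≟ f)
    ... | true  = *-comm (c f) _
    ... | false = *-zeroʳ (c f)

    column : ∀ i → ∑[ f < m ] (c f * entry i f)
                 ≡ (if does (vert G i ≟ v) then signℚ (sgn G i) * c (edge G i) else 0ℚ)
    column i with does (vert G i ≟ v)
    ... | true  = trans (sum-cong-≗ (weighted i)) (∑-indicator (edge G i) _)
    ... | false = trans (sum-cong-≗ (λ f → *-zeroʳ (c f))) (sum-replicate-zero m)

  incidenceSum-cong : ∀ {x y} → (∀ i → x i ≡ y i) → ∀ v → incidenceSum x v ≡ incidenceSum y v
  incidenceSum-cong x≗y v =
    sum-cong-≗ λ i → cong (λ z → if does (vert G i ≟ v) then signℚ (sgn G i) * z else 0ℚ) (x≗y i)

  incidenceSum-scale : (ρ : Fin n → ℚ) → ∀ {x y} → (∀ i → y i ≡ ρ (vert G i) * x i) →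
                       ∀ v → incidenceSum y v ≡ ρ v * incidenceSum x v
  incidenceSum-scale ρ {x} {y} y≡ρx v =
    trans (sum-cong-≗ scaled)
          (sym (*-distribˡ-sum (ρ v) (λ i → if does (vert G i ≟ v) then signℚ (sgn G i) * x i else 0ℚ)))
    where
    scaled : ∀ i → (if does (vert G i ≟ v) then signℚ (sgn G i) * y i else 0ℚ)
                 ≡ ρ v * (if does (vert G i ≟ v) then signℚ (sgn G i) * x i else 0ℚ)
    scaled i with vert G i ≟ v
    ... | yes refl =
      trans (cong (signℚ (sgn G i) *_) (y≡ρx i)) (x∙yz≈y∙xz (signℚ (sgn G i)) (ρ (vert G i)) (x i))
    ... | no _     = sym (*-zeroʳ (ρ v))

  minimallyDependent⇒fullSupport : MinimallyDependent G → ∀ {S} (dep : ColumnsDependent G S) →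
                                   ∀ f → proj₁ dep f ≢ 0ℚ
  minimallyDependent⇒fullSupport (_ , minimal) (c , _ , nonzero , rows) f cf≡0 =
    minimal (∁ ⁅ f ⁆) (f , x∈p⇒x∉∁p (x∈⁅x⁆ f)) (c , vanishes , nonzero , rows)
    where
    vanishes : ∀ g → g ∉ ∁ ⁅ f ⁆ → c g ≡ 0ℚ
    vanishes g g∉ = trans (cong c (x∈⁅y⁆⇒x≡y f (x∉∁p⇒x∈p g∉))) cf≡0

First : (ℕ → Set) → ℕ → Set
First P t = P t × (∀ s → s < t → ¬ P s)

first-unique : ∀ {P s t} → First P s → First P t → s ≡ t
first-unique {s = s} {t} (ps , s-least) (pt , t-least) with <-cmp s t
... | tri< s<t _ _ = ⊥-elim (t-least s s<t ps)
... | tri≈ _ s≡t _ = s≡t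
... | tri> _ _ t<s = ⊥-elim (s-least t t<s pt)

first-or-none : ∀ {P} → (∀ t → Dec (P t)) → ∀ t → ∃ (First P) ⊎ (∀ s → s < t → ¬ P s)
first-or-none P? zero = inj₂ λ _ ()
first-or-none P? (suc t) with first-or-none P? t
... | inj₁ first = inj₁ first
... | inj₂ none with P? t
...   | yes pt  = inj₁ (t , pt , none)
...   | no ¬pt  = inj₂ λ s s<1+t → [ none s , (λ { refl → ¬pt }) ] (m<1+n⇒m<n∨m≡n s<1+t)

first-exists : ∀ {P} → (∀ t → Dec (P t)) → ∀ {t} → P t → ∃ (First P)
first-exists P? {t} pt = [ id , (λ none → ⊥-elim (none t (n<1+n t) pt)) ] (first-or-none P? (suc t))

-- Breadth-first search from the edge `source` in the bipartite graph whose links `i` join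
-- `vertexOf i` and `edgeOf i`.
module Reachability {V E I : ℕ} (vertexOf : Fin I → Fin V) (edgeOf : Fin I → Fin E) (source : Fin E) where

  reachedE : ℕ → Fin E → Bool
  reachedV : ℕ → Fin V → Bool
  reachedV t v = isYes (any? λ i → (vertexOf i ≟ v) ×-dec T? (reachedE t (edgeOf i)))
  reachedE zero    x = isYes (source ≟ x)
  reachedE (suc t) x = reachedE t x ∨ isYes (any? λ i → (edgeOf i ≟ x) ×-dec T? (reachedV t (vertexOf i)))

  ReachedE : ℕ → Fin E → Set
  ReachedE t x = T (reachedE t x)

  ReachedV : ℕ → Fin V → Set
  ReachedV t v = T (reachedV t v)

  FirstE : ℕ → Fin E → Set
  FirstE t x = First (λ s → ReachedE s x) t

  FirstV : ℕ → Fin V → Set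
  FirstV t v = First (λ s → ReachedV s v) t

  reachedE-zero : ∀ {x} → ReachedE 0 x → source ≡ x
  reachedE-zero = toWitness

  reachedV-link : ∀ {t} i → ReachedE t (edgeOf i) → ReachedV t (vertexOf i)
  reachedV-link i r = fromWitness (i , refl , r)

  reachedE-link : ∀ {t} i → ReachedV t (vertexOf i) → ReachedE (suc t) (edgeOf i)
  reachedE-link {t} i r = Equivalence.from (T-∨ {reachedE t (edgeOf i)}) (inj₂ (fromWitness (i , refl , r)))

  reachedV-witness : ∀ {t v} → ReachedV t v → ∃ λ i → vertexOf i ≡ v × ReachedE t (edgeOf i)
  reachedV-witness = toWitness

  reachedE-suc-witness : ∀ {t x} → ReachedE (suc t) x →
                         ReachedE t x ⊎ ∃ λ i → edgeOf i ≡ x × ReachedV t (vertexOf i)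
  reachedE-suc-witness {t} {x} r = map₂ toWitness (Equivalence.to (T-∨ {reachedE t x}) r)

  reachedE-mono : ∀ {s t x} → s ≤ t → ReachedE s x → ReachedE t x
  reachedE-mono {t = zero}  z≤n r = r
  reachedE-mono {s} {suc t} {x} s≤1+t r with m<1+n⇒m<n∨m≡n (s≤s s≤1+t)
  ... | inj₁ (s≤s s≤t) = Equivalence.from (T-∨ {reachedE t x}) (inj₁ (reachedE-mono {s} {t} s≤t r))
  ... | inj₂ refl      = r

  source-reached : ∀ t → ReachedE t source
  source-reached t = reachedE-mono {0} {t} z≤n (fromWitness refl)

  firstE-suc-link : ∀ {t x} → FirstE (suc t) x → ∃ λ i → edgeOf i ≡ x × FirstV t (vertexOf i)
  firstE-suc-link {t} (r , least) with reachedE-suc-witness {t} r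
  ... | inj₁ earlier         = ⊥-elim (least t (n<1+n t) earlier)
  ... | inj₂ (i , refl , rv) = i , refl , rv , λ s s<t rs → least (suc s) (s≤s s<t) (reachedE-link {s} i rs)

  firstV-link : ∀ {t v} → FirstV t v → ∃ λ i → vertexOf i ≡ v × FirstE t (edgeOf i)
  firstV-link {t} (r , least) with reachedV-witness {t} r
  ... | i , refl , re = i , refl , re , λ s s<t rs → least s s<t (reachedV-link {s} i rs)

  -- Read from x back to the source: edgeAt j, linkIn j, vertexAt j, linkOut j, edgeAt (suc j), …
  -- with every node in the layer of its distance from the source.
  record ShortestPath (K : ℕ) (x : Fin E) : Set where
    field
      edgeAt         : Fin (suc K) → Fin E
      vertexAt       : Fin K → Fin V
      linkIn linkOut : Fin K → Fin I
      edgeAt-zero    : edgeAt zero ≡ x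
      edgeAt-first   : ∀ j → FirstE (K ∸ toℕ j) (edgeAt j)
      vertexAt-first : ∀ j → FirstV (K ∸ suc (toℕ j)) (vertexAt j)
      linkIn-vertex  : ∀ j → vertexOf (linkIn j) ≡ vertexAt j
      linkIn-edge    : ∀ j → edgeOf (linkIn j) ≡ edgeAt (inject₁ j)
      linkOut-vertex : ∀ j → vertexOf (linkOut j) ≡ vertexAt j
      linkOut-edge   : ∀ j → edgeOf (linkOut j) ≡ edgeAt (suc j)

    edgeAt-injective : Injective _≡_ _≡_ edgeAt
    edgeAt-injective {i} {j} eq = toℕ-injective (∸-cancelˡ-≡ (toℕ≤pred[n] i) (toℕ≤pred[n] j)
      (first-unique (edgeAt-first i) (subst (FirstE (K ∸ toℕ j)) (sym eq) (edgeAt-first j))))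

    vertexAt-injective : Injective _≡_ _≡_ vertexAt
    vertexAt-injective {i} {j} eq = toℕ-injective (cong ℕ.pred (∸-cancelˡ-≡ (toℕ<n i) (toℕ<n j)
      (first-unique (vertexAt-first i) (subst (FirstV (K ∸ suc (toℕ j))) (sym eq) (vertexAt-first j)))))

    linkIn-injective : Injective _≡_ _≡_ linkIn
    linkIn-injective {i} {j} eq =
      vertexAt-injective (trans (sym (linkIn-vertex i)) (trans (cong vertexOf eq) (linkIn-vertex j)))

    linkOut-injective : Injective _≡_ _≡_ linkOut
    linkOut-injective {i} {j} eq =
      vertexAt-injective (trans (sym (linkOut-vertex i)) (trans (cong vertexOf eq) (linkOut-vertex j)))

    linkOut≢linkIn : ∀ i j → linkOut i ≢ linkIn j
    linkOut≢linkIn i j eq = 1+n≢n (trans (cong toℕ suc≡inject₁) (toℕ-inject₁ j))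
      where
      i≡j : i ≡ j
      i≡j = vertexAt-injective (trans (sym (linkOut-vertex i)) (trans (cong vertexOf eq) (linkIn-vertex j)))
      suc≡inject₁ : suc j ≡ inject₁ j
      suc≡inject₁ = subst (λ k → suc k ≡ inject₁ j) i≡j
        (edgeAt-injective (trans (sym (linkOut-edge i)) (trans (cong edgeOf eq) (linkIn-edge j))))

    edgeAt-last : edgeAt (fromℕ K) ≡ source
    edgeAt-last = sym (reachedE-zero (proj₁ (subst (λ t → FirstE t (edgeAt (fromℕ K)))
      (trans (cong (K ∸_) (toℕ-fromℕ K)) (n∸n≡0 K)) (edgeAt-first (fromℕ K)))))

  shortestPath : ∀ {K x} → FirstE K x → ShortestPath K x
  shortestPath {zero} {x} first = record
    { edgeAt = λ _ → x ; vertexAt = λ () ; linkIn = λ () ; linkOut = λ ()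
    ; edgeAt-zero = refl ; edgeAt-first = λ { zero → first }
    ; vertexAt-first = λ () ; linkIn-vertex = λ () ; linkIn-edge = λ ()
    ; linkOut-vertex = λ () ; linkOut-edge = λ () }
  shortestPath {suc K} {x} first with firstE-suc-link first
  ... | toX , refl , w-first with firstV-link w-first
  ...   | toF , toF-vertex , f-first = record
    { edgeAt = x ∷ edgeAt
    ; vertexAt = vertexOf toX ∷ vertexAt
    ; linkIn = toX ∷ linkIn
    ; linkOut = toF ∷ linkOut
    ; edgeAt-zero = refl
    ; edgeAt-first = λ { zero → first ; (suc j) → edgeAt-first j }
    ; vertexAt-first = λ { zero → w-first ; (suc j) → vertexAt-first j }
    ; linkIn-vertex = λ { zero → refl ; (suc j) → linkIn-vertex j }
    ; linkIn-edge = λ { zero → refl ; (suc j) → linkIn-edge j }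
    ; linkOut-vertex = λ { zero → toF-vertex ; (suc j) → linkOut-vertex j }
    ; linkOut-edge = λ { zero → sym edgeAt-zero ; (suc j) → linkOut-edge j } }
    where open ShortestPath (shortestPath f-first)

  firstE-bound : ∀ {K x} → FirstE K x → K < E
  firstE-bound first = injective⇒≤ (ShortestPath.edgeAt-injective (shortestPath first))

  reachedE-saturates : ∀ {t x} → ReachedE t x → ReachedE E x
  reachedE-saturates {t} {x} r with first-exists (λ s → T? (reachedE s x)) {t} r
  ... | K , first = reachedE-mono (<⇒≤ (firstE-bound first)) (proj₁ first)

  reachable : Fin E → Bool
  reachable = reachedE E

  reachableV : Fin V → Bool
  reachableV = reachedV E

  reachable-link : ∀ i → reachable (edgeOf i) ≡ reachableV (vertexOf i)
  reachable-link i = ⇔→≡ {z = true} (mk⇔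
    (λ r → Equivalence.to T-≡ (reachedV-link {E} i (Equivalence.from T-≡ r)))
    (λ r → Equivalence.to T-≡ (reachedE-saturates {suc E} (reachedE-link {E} i (Equivalence.from T-≡ r)))))

  reachable⇒shortestPath : ∀ {x} → T (reachable x) → ∃ λ K → ShortestPath K x
  reachable⇒shortestPath {x} r with first-exists (λ s → T? (reachedE s x)) {E} r
  ... | K , first = K , shortestPath first

module Subdivision {n m} (G : OHG n m) (e : Fin m) (part : Fin (L G) → Bool) (s₁ s₂ : Sign) where

  H : OHG (suc n) (suc m)
  H = subdivide G e part s₁ s₂

  u : Fin (suc n)
  u = newVertex n

  e₁ e₂ : Fin (suc m)
  e₁ = inject₁ e
  e₂ = fromℕ m

  newEdge : Fin (L G) → Fin (suc m)
  newEdge i = edge H (suc (suc i))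

  parentEdge : Fin (suc m) → Fin m
  parentEdge f with view f
  ... | ‵fromℕ          = e
  ... | ‵inj₁ {i = g} _ = g

  parentEdge-inject₁ : ∀ g → parentEdge (inject₁ g) ≡ g
  parentEdge-inject₁ g rewrite view-inject₁ g = refl

  parentEdge-e₂ : parentEdge e₂ ≡ e
  parentEdge-e₂ rewrite view-fromℕ m = refl

  parentEdge-newEdge : ∀ i → parentEdge (newEdge i) ≡ edge G i
  parentEdge-newEdge i with edge G i ≟ e
  ... | no _ = parentEdge-inject₁ (edge G i)
  ... | yes refl with part i
  ...   | true  = parentEdge-inject₁ e
  ...   | false = parentEdge-e₂

  equal-on-halves⇒factors : ∀ {A : Set} (x : Fin (suc m) → A) → x e₁ ≡ x e₂ →
                            ∀ f → x f ≡ x (inject₁ (parentEdge f))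
  equal-on-halves⇒factors x x₁≡x₂ f with view f
  ... | ‵fromℕ  = sym x₁≡x₂
  ... | ‵inj₁ _ = refl

  incidenceSum-oldVertex : ∀ (d : Fin (suc m) → ℚ) w →
                           incidenceSum H (d ∘ edge H) (inject₁ w) ≡ incidenceSum G (d ∘ newEdge) w
  incidenceSum-oldVertex d w rewrite dec-false (fromℕ n ≟ inject₁ w) fromℕ≢inject₁ =
    trans (+-identityˡ _) (trans (+-identityˡ _) (sum-cong-≗ λ i →
      cong (λ b → if b then signℚ (sgn G i) * d (newEdge i) else 0ℚ) (does-inject₁-≟ (vert G i) w)))

  incidenceSum-newVertex : ∀ (d : Fin (suc m) → ℚ) →
                           incidenceSum H (d ∘ edge H) u ≡ signℚ s₁ * d e₁ + signℚ s₂ * d e₂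
  incidenceSum-newVertex d rewrite dec-true (fromℕ n ≟ fromℕ n) refl =
    cong (signℚ s₁ * d e₁ +_) (trans (cong (signℚ s₂ * d e₂ +_) oldIncidences≡0) (+-identityʳ _))
    where
    oldIncidences≡0 : ∑[ i < L G ] (if does (inject₁ (vert G i) ≟ u) then signℚ (sgn G i) * d (newEdge i) else 0ℚ)
                      ≡ 0ℚ
    oldIncidences≡0 = trans (sum-cong-≗ λ i →
      cong (λ b → if b then signℚ (sgn G i) * d (newEdge i) else 0ℚ)
           (dec-false (inject₁ (vert G i) ≟ u) (fromℕ≢inject₁ ∘ sym))) (sum-replicate-zero (L G))

  open Reachability (vert G) newEdge e₁

  -- The circle u, e₂, vertexAt 0, …, vertexAt K, e₁, u: the path closed up by the two incidences at u.
  pathCircle : ∀ {K} → ShortestPath (suc K) e₂ → Circle H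
  pathCircle {K} path = record
    { k = suc K ; vs = vs ; es = edgeAt ; a = as ; b = bs
    ; vs-inj = vs-injective ; es-inj = edgeAt-injective ; a-inj = as-injective ; b-inj = bs-injective
    ; ab-dis = as≢bs
    ; a-vert = as-vert ; a-edge = as-edge ; b-vert = bs-vert ; b-edge = bs-edge }
    where
    open ShortestPath path

    vs : Fin (suc (suc K)) → Fin (suc n)
    vs = u ∷ (inject₁ ∘ vertexAt)

    as bs : Fin (suc (suc K)) → Fin (L H)
    as = suc zero ∷ (λ j → suc (suc (linkOut j)))
    bs j with view j
    ... | ‵fromℕ          = zero
    ... | ‵inj₁ {i = i} _ = suc (suc (linkIn i))

    vs-injective : Injective _≡_ _≡_ vs
    vs-injective {zero}  {zero}  _  = refl
    vs-injective {zero}  {suc j} eq = ⊥-elim (fromℕ≢inject₁ eq)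
    vs-injective {suc i} {zero}  eq = ⊥-elim (fromℕ≢inject₁ (sym eq))
    vs-injective {suc i} {suc j} eq = cong suc (vertexAt-injective (inject₁-injective eq))

    as-injective : Injective _≡_ _≡_ as
    as-injective {zero}  {zero}  _  = refl
    as-injective {zero}  {suc j} ()
    as-injective {suc i} {zero}  ()
    as-injective {suc i} {suc j} eq = cong suc (linkOut-injective (suc-injective (suc-injective eq)))

    bs-injective : Injective _≡_ _≡_ bs
    bs-injective {i} {j} eq with view i | view j
    bs-injective eq | ‵fromℕ  | ‵fromℕ  = refl
    bs-injective () | ‵fromℕ  | ‵inj₁ _
    bs-injective () | ‵inj₁ _ | ‵fromℕ
    bs-injective eq | ‵inj₁ _ | ‵inj₁ _ = cong inject₁ (linkIn-injective (suc-injective (suc-injective eq)))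

    as≢bs : ∀ i j → as i ≢ bs j
    as≢bs i j eq with view j
    as≢bs zero    _ () | ‵fromℕ
    as≢bs zero    _ () | ‵inj₁ _
    as≢bs (suc i) _ () | ‵fromℕ
    as≢bs (suc i) _ eq | ‵inj₁ {i = j} _ = linkOut≢linkIn i j (suc-injective (suc-injective eq))

    as-vert : ∀ i → vert H (as i) ≡ vs i
    as-vert zero    = refl
    as-vert (suc i) = cong inject₁ (linkOut-vertex i)

    as-edge : ∀ i → edge H (as i) ≡ edgeAt i
    as-edge zero    = sym edgeAt-zero
    as-edge (suc i) = linkOut-edge i

    bs-vert : ∀ i → vert H (bs i) ≡ vs (next i)
    bs-vert i with view i
    ... | ‵fromℕ          = cong vs (sym (next-fromℕ (suc K)))
    ... | ‵inj₁ {i = j} _ = trans (cong inject₁ (linkIn-vertex j)) (cong vs (sym (next-inject₁ j)))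

    bs-edge : ∀ i → edge H (bs i) ≡ edgeAt i
    bs-edge i with view i
    ... | ‵fromℕ          = sym edgeAt-last
    ... | ‵inj₁ {i = j} _ = linkIn-edge j

  noCircle⇒e₂-unreachable : ¬ OnCircle H u → ¬ T (reachable e₂)
  noCircle⇒e₂-unreachable noCircle r with reachable⇒shortestPath r
  ... | zero  , path = fromℕ≢inject₁ (trans (sym edgeAt-zero) edgeAt-last)
    where open ShortestPath path
  ... | suc K , path = noCircle (pathCircle path , zero , refl)

  -- Reversing the incidences at the edges f and old vertices w with sign − turns H into the
  -- subdivision with orientations s₁ · edgeSign e₁ and s₂ · edgeSign e₂ at u; `consistent` says that
  -- an old incidence is reversed twice or not at all.
  record Switching : Set where
    field
      edgeSign   : Fin (suc m) → Sign
      vertexSign : Fin n → Sign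
      consistent : ∀ i → edgeSign (newEdge i) ≡ vertexSign (vert G i)
      compatible : Compatible (s₁ Sign.* edgeSign e₁) (s₂ Sign.* edgeSign e₂)

  compatible⇒switching : Compatible s₁ s₂ → Switching
  compatible⇒switching c = record
    { edgeSign = λ _ → Sign.+ ; vertexSign = λ _ → Sign.+ ; consistent = λ _ → refl
    ; compatible = subst₂ Compatible (sym (*-+ s₁)) (sym (*-+ s₂)) c }
    where
    *-+ : ∀ s → s Sign.* Sign.+ ≡ s
    *-+ Sign.+ = refl
    *-+ Sign.- = refl

  incompatible⇒switching : ¬ Compatible s₁ s₂ → ¬ OnCircle H u → Switching
  incompatible⇒switching incompatible noCircle = record
    { edgeSign = sign ∘ reachable ; vertexSign = sign ∘ reachableV
    ; consistent = λ i → cong sign (reachable-link i)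
    ; compatible = subst₂ (λ a b → Compatible (s₁ Sign.* sign a) (s₂ Sign.* sign b))
                          (sym e₁-reachable) (sym e₂-unreachable)
                          (¬Compatible⇒Compatible-switched s₁ s₂ incompatible) }
    where
    sign : Bool → Sign
    sign b = if b then Sign.+ else Sign.-

    e₁-reachable : reachable e₁ ≡ true
    e₁-reachable = Equivalence.to T-≡ (source-reached (suc m))

    e₂-unreachable : reachable e₂ ≡ false
    e₂-unreachable = ¬-not (noCircle⇒e₂-unreachable noCircle ∘ Equivalence.from T-≡)

  balanced⇒switching : BalancedSubdivision G e part s₁ s₂ → Switching
  balanced⇒switching (inj₁ compatible)                = compatible⇒switching compatible
  balanced⇒switching (inj₂ (incompatible , noCircle)) = incompatible⇒switching incompatible noCircle

  module Switched (sw : Switching) where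
    open Switching sw

    ε : Fin (suc m) → ℚ
    ε f = signℚ (edgeSign f)

    t₁ t₂ : Sign
    t₁ = s₁ Sign.* edgeSign e₁
    t₂ = s₂ Sign.* edgeSign e₂

    switched-oldRow≡0 : ∀ d w → incidenceSum G (d ∘ newEdge) w ≡ 0ℚ →
                        incidenceSum G (λ i → ε (newEdge i) * d (newEdge i)) w ≡ 0ℚ
    switched-oldRow≡0 d w row≡0 = begin
      incidenceSum G (λ i → ε (newEdge i) * d (newEdge i)) w
        ≡⟨ incidenceSum-scale G (signℚ ∘ vertexSign)
             (λ i → cong (λ s → signℚ s * d (newEdge i)) (consistent i)) w ⟩
      signℚ (vertexSign w) * incidenceSum G (d ∘ newEdge) w  ≡⟨ cong (signℚ (vertexSign w) *_) row≡0 ⟩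
      signℚ (vertexSign w) * 0ℚ                              ≡⟨ *-zeroʳ (signℚ (vertexSign w)) ⟩
      0ℚ                                                     ∎

    switched-newRow : ∀ x y → signℚ s₁ * (ε e₁ * x) + signℚ s₂ * (ε e₂ * y) ≡ signℚ t₁ * x + signℚ t₂ * y
    switched-newRow x y = cong₂ _+_ (signℚ-*-assoc s₁ (edgeSign e₁) x) (signℚ-*-assoc s₂ (edgeSign e₂) y)

    switched-halves : ∀ d → incidenceSum H (d ∘ edge H) u ≡ 0ℚ → ε e₁ * d e₁ ≡ ε e₂ * d e₂
    switched-halves d row≡0 = compatible-balanced t₁ t₂ compatible {ε e₁ * d e₁} {ε e₂ * d e₂} (begin
      signℚ t₁ * (ε e₁ * d e₁) + signℚ t₂ * (ε e₂ * d e₂)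
        ≡⟨ sym (switched-newRow (ε e₁ * d e₁) (ε e₂ * d e₂)) ⟩
      signℚ s₁ * (ε e₁ * (ε e₁ * d e₁)) + signℚ s₂ * (ε e₂ * (ε e₂ * d e₂))
        ≡⟨ cong₂ (λ a b → signℚ s₁ * a + signℚ s₂ * b)
                 (signℚ-involutive (edgeSign e₁) (d e₁)) (signℚ-involutive (edgeSign e₂) (d e₂)) ⟩
      signℚ s₁ * d e₁ + signℚ s₂ * d e₂  ≡⟨ sym (incidenceSum-newVertex d) ⟩
      incidenceSum H (d ∘ edge H) u      ≡⟨ row≡0 ⟩
      0ℚ                                 ∎)

    contracted-row≡0 : ∀ d (c : Fin m → ℚ) → (∀ f → ε f * d f ≡ c (parentEdge f)) →
                       (∀ w → incidenceSum G (d ∘ newEdge) w ≡ 0ℚ) → ∀ w → incidenceSum G (c ∘ edge G) w ≡ 0ℚ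
    contracted-row≡0 d c factors oldRow≡0 w = begin
      incidenceSum G (c ∘ edge G) w
        ≡⟨ incidenceSum-cong G {c ∘ edge G} {λ i → ε (newEdge i) * d (newEdge i)}
             (λ i → trans (cong c (sym (parentEdge-newEdge i))) (sym (factors (newEdge i)))) w ⟩
      incidenceSum G (λ i → ε (newEdge i) * d (newEdge i)) w
        ≡⟨ switched-oldRow≡0 d w (oldRow≡0 w) ⟩
      0ℚ ∎

    expand : ColumnsDependent G ⊤ → ColumnsDependent H ⊤
    expand (c , _ , (g , cg≢0) , rows) = d , (λ f f∉ → ⊥-elim (f∉ ∈⊤)) , (inject₁ g , dg≢0) ,
                                         (λ v → trans (combination≡incidenceSum H d v) (row v))
      where
      d : Fin (suc m) → ℚ
      d f = ε f * c (parentEdge f)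

      dg≢0 : d (inject₁ g) ≢ 0ℚ
      dg≢0 dg≡0 = cg≢0 (trans (cong c (sym (parentEdge-inject₁ g))) (signℚ-cancel (edgeSign (inject₁ g)) dg≡0))

      oldRowG : ∀ w → incidenceSum G (c ∘ parentEdge ∘ newEdge) w ≡ 0ℚ
      oldRowG w = begin
        incidenceSum G (c ∘ parentEdge ∘ newEdge) w
          ≡⟨ incidenceSum-cong G (λ i → cong c (parentEdge-newEdge i)) w ⟩
        incidenceSum G (c ∘ edge G) w    ≡⟨ sym (combination≡incidenceSum G c w) ⟩
        Σℚ m (λ f → c f * incMat G w f)  ≡⟨ rows w ⟩
        0ℚ                               ∎

      row : ∀ v → incidenceSum H (d ∘ edge H) v ≡ 0ℚ
      row v with view v
      ... | ‵fromℕ = begin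
        incidenceSum H (d ∘ edge H) u  ≡⟨ incidenceSum-newVertex d ⟩
        signℚ s₁ * d e₁ + signℚ s₂ * d e₂
          ≡⟨ switched-newRow (c (parentEdge e₁)) (c (parentEdge e₂)) ⟩
        signℚ t₁ * c (parentEdge e₁) + signℚ t₂ * c (parentEdge e₂)
          ≡⟨ cong₂ (λ a b → signℚ t₁ * c a + signℚ t₂ * c b)
                   (parentEdge-inject₁ e) parentEdge-e₂ ⟩
        signℚ t₁ * c e + signℚ t₂ * c e
          ≡⟨ compatible-cancels t₁ t₂ compatible (c e) ⟩
        0ℚ                             ∎
      ... | ‵inj₁ {i = w} _ =
        trans (incidenceSum-oldVertex d w) (switched-oldRow≡0 (c ∘ parentEdge) w (oldRowG w))

    contract : ∀ d (c : Fin m → ℚ) → (∀ f → ε f * d f ≡ c (parentEdge f)) →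
               (∃ λ g → d g ≢ 0ℚ) → (∀ v → Σℚ (suc m) (λ f → d f * incMat H v f) ≡ 0ℚ) →
               ColumnsDependent G ⊤
    contract d c factors (g , dg≢0) rows =
      c , (λ f f∉ → ⊥-elim (f∉ ∈⊤)) , (parentEdge g , c≢0) ,
      (λ w → trans (combination≡incidenceSum G c w) (contracted-row≡0 d c factors oldRow≡0 w))
      where
      c≢0 : c (parentEdge g) ≢ 0ℚ
      c≢0 c≡0 = dg≢0 (signℚ-cancel (edgeSign g) (trans (factors g) c≡0))

      oldRow≡0 : ∀ w → incidenceSum G (d ∘ newEdge) w ≡ 0ℚ
      oldRow≡0 w = trans (sym (incidenceSum-oldVertex d w))
                         (trans (sym (combination≡incidenceSum H d (inject₁ w))) (rows (inject₁ w)))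

    minimallyDependent-subdivide : MinimallyDependent G → MinimallyDependent H
    minimallyDependent-subdivide minG@(depG , _) = expand depG , independent
      where
      independent : ∀ S → (∃ λ f → f ∉ S) → ¬ ColumnsDependent H S
      independent S (f , f∉S) (d , outside , nonzero , rows) =
        minimallyDependent⇒fullSupport G minG (contract d c factors nonzero rows) (parentEdge f) cf≡0
        where
        c : Fin m → ℚ
        c h = ε (inject₁ h) * d (inject₁ h)

        factors : ∀ f → ε f * d f ≡ c (parentEdge f)
        factors = equal-on-halves⇒factors (λ f → ε f * d f)
          (switched-halves d (trans (sym (combination≡incidenceSum H d u)) (rows u)))

        cf≡0 : c (parentEdge f) ≡ 0ℚ
        cf≡0 = trans (sym (factors f)) (trans (cong (ε f *_) (outside f f∉S)) (*-zeroʳ (ε f)))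

mainTheorem8 : (n m : ℕ) (G : OHG n m) → MinimallyDependent G →
    (e : Fin m) (part : Fin (L G) → Bool) (s₁ s₂ : Sign) →
    BalancedSubdivision G e part s₁ s₂ →
    MinimallyDependent (subdivide G e part s₁ s₂)
mainTheorem8 n m G minG e part s₁ s₂ balanced =
  Switched.minimallyDependent-subdivide (balanced⇒switching balanced) minG
  where open Subdivision G e part s₁ s₂
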